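{- Let $t$ be a positive integer and $q\ge 2$. (1) If $2\le n<t$, then $M(\overline{t},n,q)=n(q-1)$. (2) If $n=t$, then $M(\overline{t},n,q)\le q^2$ if $n\le q$, and $M(\overline{t},n,q)\le nq$ otherwise.
   Context: An $(n,M,q)$ code is a set $\mathcal{C}\subseteq Q^n$ of $M$ distinct codewords, $|Q|=q$. For $\mathcal{C}_0\subseteq\mathcal{C}$, let $\mathcal{C}_0(i)=\{\mathbf{c}(i):\mathbf{c}\in\mathcal{C}_0\}$ and $\mathsf{desc}(\mathcal{C}_0)=\mathcal{C}_0(1)\times\cdots\times\mathcal{C}_0(n)$. $\mathcal{C}$ is a strongly $\overline{t}$-separable code ($\overline{t}$-SSC$(n,M,q)$) if for every $\mathcal{C}_0\subseteq\mathcal{C}$ with $1\le|\mathcal{C}_0|\le t$, $\bigcap_{\mathcal{C}'\in S(\mathcal{C}_0)}\mathcal{C}'=\mathcal{C}_0$, where $S(\mathcal{C}_0)=\{\mathcal{C}'\subseteq\mathcal{C}:\mathsf{desc}(\mathcal{C}')=\mathsf{desc}(\mathcal{C}_0)\}$. $M(\overline{t},n,q)$ denotes the maximum $M$ such that a $\overline{t}$-SSC$(n,M,q)$ exists. -}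

module Defs where

open import Data.Nat using (ℕ; _≤_)
open import Data.Fin using (Fin)
open import Data.Fin.Subset using (Subset; _∈_; ∣_∣)
open import Data.Vec using (Vec; lookup)
open import Data.Product using (_×_; ∃-syntax)
open import Relation.Binary.PropositionalEquality using (_≡_)

Word : ℕ → ℕ → Set
Word n q = Vec (Fin q) n

-- An (n,M,q) code: M codewords indexed by Fin M, required to be distinct.
Distinct : ∀ {n q M} → (Fin M → Word n q) → Set
Distinct {M = M} c = (a b : Fin M) → c a ≡ c b → a ≡ b

-- A subcode C0 ⊆ C is a subset of the indices of the codewords.
-- w ∈ desc(C0) = C0(1) × ... × C0(n)  iff  every coordinate w(i) lies in C0(i).
InDesc : ∀ {n q M} → (Fin M → Word n q) → Subset M → Word n q → Set
InDesc {n} {q} {M} c s w =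
  (i : Fin n) → ∃[ a ] (a ∈ s × lookup (c a) i ≡ lookup w i)

SameDesc : ∀ {n q M} → (Fin M → Word n q) → Subset M → Subset M → Set
SameDesc {n} {q} c s' s =
  (w : Word n q) → (InDesc c s' w → InDesc c s w) × (InDesc c s w → InDesc c s' w)

-- Strongly t-bar-separable: for every C0 with 1 ≤ |C0| ≤ t, the intersection of
-- all C' in S(C0) = {C' ⊆ C : desc(C') = desc(C0)} equals C0.
IsSSC : ∀ {n q M} → ℕ → (Fin M → Word n q) → Set
IsSSC {M = M} t c =
  (s : Subset M) → 1 ≤ ∣ s ∣ → ∣ s ∣ ≤ t →
  (a : Fin M) →
    (a ∈ s → (s' : Subset M) → SameDesc c s' s → a ∈ s') ×
    (((s' : Subset M) → SameDesc c s' s → a ∈ s') → a ∈ s)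

SSCBound : ℕ → ℕ → ℕ → ℕ → Set
SSCBound t n q m =
  (M : ℕ) (c : Fin M → Word n q) → Distinct c → IsSSC t c → M ≤ m

-- M(t,n,q) = m : a t-SSC(n,m,q) exists and m bounds all t-SSC(n,M,q).
MaxSSC : ℕ → ℕ → ℕ → ℕ → Set
MaxSSC t n q m =
  (∃[ c ] (Distinct {n} {q} {m} c × IsSSC t c)) × SSCBound t n q m

module Submission where

open import Defs
open import Data.Nat using (ℕ; _≤_; _<_; _*_; _∸_; _^_)
open import Data.Product using (_×_)
open import Relation.Binary.PropositionalEquality using (_≡_)

open import Data.Fin using (Fin; zero; suc; punchIn; punchOut; remQuot; combine)
open import Data.Fin.Properties as Fin using (any?; all?; ¬∀⟶∃¬)
open import Data.Fin.Subset using (Subset; ⁅_⁆; _∪_; ∣_∣; _∈_; inside; outside) renaming (⊥ to ∅)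
open import Data.Fin.Subset.Properties
  using (x∈p∪q⁺; x∈p∪q⁻; x∈⁅x⁆; x∈⁅y⁆⇒x≡y; ∉⊥; ∣⁅x⁆∣≡1; ∣p∣≤∣p∪q∣; ∣⊥∣≡0)
open import Data.List using ([]; _∷_)
open import Data.Nat using (zero; suc; _+_; z≤n; s≤s; s≤s⁻¹; NonZero; _≟_)
open import Data.Nat.Properties
open import Data.Nat.Tactic.RingSolver using (solve)
open import Algebra.Properties.Semiring.Sum +-*-semiring
  using (sum; sum-syntax; sum-cong-≗; sum-replicate-zero; sum-remove;
         ∑-comm; ∑-distrib-+; *-distribˡ-sum; *-distribʳ-sum)
open import Data.Product using (∃-syntax; _,_; proj₁; proj₂; uncurry)
open import Data.Sum using (inj₁; inj₂)
open import Data.Vec using (lookup; tabulate)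
open import Data.Vec.Properties using (lookup∘tabulate; tabulate∘lookup; tabulate-cong)
open import Data.Vec.Functional using (updateAt; removeAt) renaming (_∷_ to _◂_)
open import Data.Vec.Functional.Properties using (updateAt-updates; updateAt-minimal)
open import Function using (_∘_; id)
open import Relation.Nullary using (Dec; yes; no; ¬_; _×-dec_; _→-dec_; ¬?; contradiction)
open import Relation.Unary using (Decidable)
open import Relation.Binary.PropositionalEquality
  using (refl; sym; trans; cong; subst; _≢_; module ≡-Reasoning)

-- Call a codeword an owner if at some coordinate its symbol occurs in no other codeword.
-- A non-owner a is covered by codewords b₁, …, bₙ ≠ a with bᵢ agreeing with a at coordinate i;
-- adding a to {b₁, …, bₙ} does not change the descendant set, which strong t̄-separability
-- forbids as soon as n < t. So for n < t every codeword owns a (coordinate, symbol) slot and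
-- M ≤ n(q − 1) by counting those slots (a coordinate all of whose q symbols are owned already
-- forces M ≤ q); the words of weight one attain this. For n = t, if a non-owner a agreed with
-- some b ≠ a at two coordinates, b could replace two of the bᵢ and n − 1 codewords would cover
-- a; so a non-owner agrees with any other codeword in at most one coordinate. Hence the
-- non-owners inject into pairs of non-unique symbols at any two coordinates, and double
-- counting owners against unique slots and non-owners against non-unique ones gives M ≤ q²
-- or M ≤ nq.

sum-const : ∀ m k → ∑[ i < m ] k ≡ m * k
sum-const zero    k = refl
sum-const (suc m) k = cong (k +_) (sum-const m k)

sum-mono-≤ : ∀ {m} {f g : Fin m → ℕ} → (∀ i → f i ≤ g i) → sum f ≤ sum g
sum-mono-≤ {zero}  f≤g = z≤n
sum-mono-≤ {suc m} f≤g = +-mono-≤ (f≤g zero) (sum-mono-≤ (f≤g ∘ suc))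

private variable
  A B : Set

indicator : Dec A → ℕ
indicator (yes _) = 1
indicator (no _)  = 0

indicator-yes : (A? : Dec A) → A → indicator A? ≡ 1
indicator-yes (yes _) _ = refl
indicator-yes (no ¬a) a = contradiction a ¬a

indicator-no : (A? : Dec A) → ¬ A → indicator A? ≡ 0
indicator-no (yes a) ¬a = contradiction a ¬a
indicator-no (no _)  _  = refl

indicator≤1 : (A? : Dec A) → indicator A? ≤ 1
indicator≤1 (yes _) = ≤-refl
indicator≤1 (no _)  = z≤n

indicator-× : (A? : Dec A) (B? : Dec B) → indicator (A? ×-dec B?) ≡ indicator A? * indicator B?
indicator-× (yes _) (yes _) = refl
indicator-× (yes _) (no _)  = refl
indicator-× (no _)  _       = refl

indicator+indicator¬ : (A? : Dec A) → indicator A? + indicator (¬? A?) ≡ 1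
indicator+indicator¬ (yes _) = refl
indicator+indicator¬ (no _)  = refl

count : ∀ {m} {P : Fin m → Set} → Decidable P → ℕ
count {m} P? = ∑[ x < m ] indicator (P? x)

module _ {m : ℕ} {P : Fin m → Set} (P? : Decidable P) where

  count-none : (∀ x → ¬ P x) → count P? ≡ 0
  count-none ¬P = trans (sum-cong-≗ (λ x → indicator-no (P? x) (¬P x))) (sum-replicate-zero m)

  count-all : (∀ x → P x) → count P? ≡ m
  count-all allP =
    trans (sum-cong-≗ (λ x → indicator-yes (P? x) (allP x))) (trans (sum-const m 1) (*-identityʳ m))

  count≤ : count P? ≤ m
  count≤ = ≤-trans (sum-mono-≤ (indicator≤1 ∘ P?)) (≤-reflexive (trans (sum-const m 1) (*-identityʳ m)))

  count+count¬ : count P? + count (¬? ∘ P?) ≡ m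
  count+count¬ = begin
    count P? + count (¬? ∘ P?)                             ≡⟨ ∑-distrib-+ (indicator ∘ P?) (indicator ∘ ¬? ∘ P?) ⟨
    ∑[ x < m ] (indicator (P? x) + indicator (¬? (P? x)))  ≡⟨ sum-cong-≗ (indicator+indicator¬ ∘ P?) ⟩
    ∑[ x < m ] 1                                           ≡⟨ sum-const m 1 ⟩
    m * 1                                                  ≡⟨ *-identityʳ m ⟩
    m                                                      ∎
    where open ≡-Reasoning

count-pointed : ∀ {m} {P : Fin (suc m) → Set} (P? : Decidable P) x →
                count P? ≡ indicator (P? x) + count (P? ∘ punchIn x)
count-pointed P? x = sum-remove {i = x} (indicator ∘ P?)

count>0 : ∀ {m} {P : Fin m → Set} (P? : Decidable P) {x} → P x → 1 ≤ count P?
count>0 {suc m} P? {x} Px = begin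
  1                                          ≡⟨ indicator-yes (P? x) Px ⟨
  indicator (P? x)                           ≤⟨ m≤m+n _ _ ⟩
  indicator (P? x) + count (P? ∘ punchIn x)  ≡⟨ count-pointed P? x ⟨
  count P?                                   ∎
  where open ≤-Reasoning

count≡⇒all : ∀ {m} {P : Fin m → Set} (P? : Decidable P) → count P? ≡ m → ∀ x → P x
count≡⇒all {suc m} P? full x with P? x in P?x
... | yes Px = Px
... | no _   = contradiction (begin-strict
  count P?                                   ≡⟨ count-pointed P? x ⟩
  indicator (P? x) + count (P? ∘ punchIn x)  ≡⟨ cong (λ d → indicator d + count (P? ∘ punchIn x)) P?x ⟩
  count (P? ∘ punchIn x)                     ≤⟨ count≤ (P? ∘ punchIn x) ⟩
  m                                          <⟨ n<1+n m ⟩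
  suc m                                      ∎) (<-irrefl full)
  where open ≤-Reasoning

count≤1 : ∀ {m} {P : Fin m → Set} (P? : Decidable P) → (∀ x y → P x → P y → x ≡ y) → count P? ≤ 1
count≤1 {zero}  P? unique = z≤n
count≤1 {suc m} {P} P? unique with P? zero
... | yes P0 = ≤-reflexive (cong suc (count-none (P? ∘ suc) P0⇒¬Psuc))
  where
  P0⇒¬Psuc : ∀ x → ¬ P (suc x)
  P0⇒¬Psuc x Px = Fin.0≢1+n (unique zero (suc x) P0 Px)
... | no _   = count≤1 (P? ∘ suc) (λ x y Px Py → Fin.suc-injective (unique (suc x) (suc y) Px Py))

count-singleton : ∀ {m} (x : Fin m) → count (x Fin.≟_) ≡ 1
count-singleton x =
  ≤-antisym (count≤1 (x Fin.≟_) (λ y z x≡y x≡z → trans (sym x≡y) x≡z)) (count>0 (x Fin.≟_) refl)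

indicator-∃≤count : ∀ {m} {P : Fin m → Set} (P? : Decidable P) → indicator (any? P?) ≤ count P?
indicator-∃≤count P? with any? P?
... | yes (x , Px) = count>0 P? Px
... | no _         = z≤n

module _ {m k : ℕ} {P : Fin m → Set} (P? : Decidable P) (f : Fin m → Fin k) where

  fibre? : ∀ y → Decidable (λ x → P x × f x ≡ y)
  fibre? y x = P? x ×-dec (f x Fin.≟ y)

  count-partition : count P? ≡ ∑[ y < k ] count (fibre? y)
  count-partition = begin
    ∑[ x < m ] [P] x                                         ≡⟨ sum-cong-≗ {m} (λ x → *-identityʳ ([P] x)) ⟨
    ∑[ x < m ] ([P] x * 1)                                   ≡⟨ sum-cong-≗ {m} [P]*1≡[P]*count ⟩
    ∑[ x < m ] ([P] x * count (f x Fin.≟_))                  ≡⟨ sum-cong-≗ {m} [P]*count≡sum ⟩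
    ∑[ x < m ] ∑[ y < k ] ([P] x * indicator (f x Fin.≟ y))  ≡⟨ sum-cong-≗ {m} indicator-fibre ⟨
    ∑[ x < m ] ∑[ y < k ] indicator (fibre? y x)             ≡⟨ ∑-comm (λ x y → indicator (fibre? y x)) ⟩
    ∑[ y < k ] count (fibre? y)                              ∎
    where
    open ≡-Reasoning
    [P] : Fin m → ℕ
    [P] x = indicator (P? x)
    [P]*1≡[P]*count : ∀ x → [P] x * 1 ≡ [P] x * count (f x Fin.≟_)
    [P]*1≡[P]*count x = cong ([P] x *_) (sym (count-singleton (f x)))
    [P]*count≡sum : ∀ x → [P] x * count (f x Fin.≟_) ≡ ∑[ y < k ] ([P] x * indicator (f x Fin.≟ y))
    [P]*count≡sum x = *-distribˡ-sum ([P] x) (indicator ∘ (f x Fin.≟_))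
    indicator-fibre : ∀ x → ∑[ y < k ] indicator (fibre? y x) ≡ ∑[ y < k ] ([P] x * indicator (f x Fin.≟ y))
    indicator-fibre x = sum-cong-≗ {k} (λ y → indicator-× (P? x) (f x Fin.≟ y))

  module _ {R : Fin k → Set} (R? : Decidable R) (P⇒R : ∀ x → P x → R (f x)) where

    count-≤-fibres : ∀ {B} → (∀ y → count (fibre? y) ≤ B) → count P? ≤ count R? * B
    count-≤-fibres {B} fibre≤B = begin
      count P?                           ≡⟨ count-partition ⟩
      ∑[ y < k ] count (fibre? y)        ≤⟨ sum-mono-≤ fibre≤ ⟩
      ∑[ y < k ] (indicator (R? y) * B)  ≡⟨ *-distribʳ-sum B (indicator ∘ R?) ⟨
      count R? * B                       ∎
      where
      open ≤-Reasoning
      fibre≤ : ∀ y → count (fibre? y) ≤ indicator (R? y) * B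
      fibre≤ y with R? y
      ... | yes _ = ≤-trans (fibre≤B y) (≤-reflexive (sym (*-identityˡ B)))
      ... | no ¬R = ≤-reflexive (count-none (fibre? y) (λ x (Px , fx≡y) → ¬R (subst R fx≡y (P⇒R x Px))))

    count-injective-≤ : (∀ x y → P x → P y → f x ≡ f y → x ≡ y) → count P? ≤ count R?
    count-injective-≤ inj = ≤-trans (count-≤-fibres fibre≤1) (≤-reflexive (*-identityʳ _))
      where
      fibre≤1 : ∀ y → count (fibre? y) ≤ 1
      fibre≤1 y = count≤1 (fibre? y) λ x x′ (Px , fx≡y) (Px′ , fx′≡y) →
                    inj x x′ Px Px′ (trans fx≡y (sym fx′≡y))

q≤2*[q∸1] : ∀ {q} → 2 ≤ q → q ≤ 2 * (q ∸ 1)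
q≤2*[q∸1] (s≤s (s≤s {n = r} _)) =
  s≤s (≤-trans (m≤n+m (suc r) r) (≤-reflexive (cong (r +_) (sym (+-identityʳ (suc r))))))

q^2≡q*q : ∀ q → q ^ 2 ≡ q * q
q^2≡q*q q = cong (q *_) (*-identityʳ q)

-- The counting behind the case n = t = suc m: O owners and N non-owners, U unique
-- (coordinate, symbol) slots out of (suc m) q, a non-unique symbols at the first coordinate
-- and S at the other m coordinates, with m N ≤ a S from the injections of the non-owners.
many-shared-bound : ∀ m {U N a S q} .{{_ : NonZero m}} → U + (a + S) ≡ suc m * q → m * N ≤ a * S →
                    m ≤ a → a ≤ q → S ≤ m * q → U + N ≤ q * q
many-shared-bound m@(suc k) {U} {N} {S = S} slots mN≤aS m≤a a≤q S≤mq
  with d , refl ← m≤n⇒∃[o]m+o≡n m≤a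
  with f , refl ← m≤n⇒∃[o]m+o≡n a≤q
  with g , S+g≡mq ← m≤n⇒∃[o]m+o≡n S≤mq
  = *-cancelˡ-≤ m (begin
    m * (U + N)                                          ≡⟨ *-distribˡ-+ m U N ⟩
    m * U + m * N                                        ≤⟨ +-monoʳ-≤ (m * U) mN≤aS ⟩
    m * U + (m + d) * S                                  ≤⟨ m≤m+n (m * U + (m + d) * S) (d * g) ⟩
    m * U + (m + d) * S + d * g                          ≡⟨ cong (λ u → m * u + (m + d) * S + d * g) U≡f+g ⟩
    m * (f + g) + (m + d) * S + d * g                    ≡⟨ solve (k ∷ d ∷ f ∷ g ∷ S ∷ []) ⟩
    m * f + (m + d) * (S + g)                            ≡⟨ cong (λ x → m * f + (m + d) * x) S+g≡mq ⟩
    m * f + (m + d) * (m * (m + d + f))                  ≤⟨ +-monoˡ-≤ _ (*-monoʳ-≤ m (m≤m*n f (m + d + f))) ⟩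
    m * (f * (m + d + f)) + (m + d) * (m * (m + d + f))  ≡⟨ solve (k ∷ d ∷ f ∷ []) ⟩
    m * ((m + d + f) * (m + d + f))                      ∎)
  where
  open ≤-Reasoning
  U≡f+g : U ≡ f + g
  U≡f+g = +-cancelʳ-≡ (m + d + S) U (f + g) (begin-equality
    U + (m + d + S)      ≡⟨ slots ⟩
    suc m * (m + d + f)  ≡⟨ cong (m + d + f +_) S+g≡mq ⟨
    m + d + f + (S + g)  ≡⟨ solve (k ∷ d ∷ f ∷ g ∷ S ∷ []) ⟩
    f + g + (m + d + S)  ∎)

slots-bound : ∀ m {O N U a S q} .{{_ : NonZero m}} → U + (a + S) ≡ suc m * q → O ≤ U → m * N ≤ a * S →
              a ≤ q → S ≤ m * q → (q < suc m → O + N ≤ suc m * q) × (suc m ≤ q → O + N ≤ q ^ 2)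
slots-bound m {O} {N} {U} {a} {S} {q} slots O≤U mN≤aS a≤q S≤mq =
  (λ q≤m → few-shared (≤-trans a≤q (s≤s⁻¹ q≤m))) , large-q
  where
  open ≤-Reasoning
  few-shared : a ≤ m → O + N ≤ suc m * q
  few-shared a≤m = begin
    O + N        ≤⟨ +-mono-≤ O≤U (*-cancelˡ-≤ m (≤-trans mN≤aS (*-monoˡ-≤ S a≤m))) ⟩
    U + S        ≤⟨ +-monoʳ-≤ U (m≤n+m S a) ⟩
    U + (a + S)  ≡⟨ slots ⟩
    suc m * q    ∎
  large-q : suc m ≤ q → O + N ≤ q ^ 2
  large-q m<q with ≤-total a m
  ... | inj₁ a≤m = begin
    O + N      ≤⟨ few-shared a≤m ⟩
    suc m * q  ≤⟨ *-monoˡ-≤ q m<q ⟩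
    q * q      ≡⟨ q^2≡q*q q ⟨
    q ^ 2      ∎
  ... | inj₂ m≤a = begin
    O + N      ≤⟨ +-monoˡ-≤ N O≤U ⟩
    U + N      ≤⟨ many-shared-bound m slots mN≤aS m≤a a≤q S≤mq ⟩
    q * q      ≡⟨ q^2≡q*q q ⟨
    q ^ 2      ∎

-- Vec's constructors are imported only here: overloading them with List's makes the ring
-- solver calls above extremely slow.
module _ where
  open import Data.Vec using ([]; _∷_)

  ∣p∪q∣≤∣p∣+∣q∣ : ∀ {m} (p q : Subset m) → ∣ p ∪ q ∣ ≤ ∣ p ∣ + ∣ q ∣
  ∣p∪q∣≤∣p∣+∣q∣ []            []            = z≤n
  ∣p∪q∣≤∣p∣+∣q∣ (outside ∷ p) (outside ∷ q) = ∣p∪q∣≤∣p∣+∣q∣ p q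
  ∣p∪q∣≤∣p∣+∣q∣ (outside ∷ p) (inside ∷ q)  =
    ≤-trans (s≤s (∣p∪q∣≤∣p∣+∣q∣ p q)) (≤-reflexive (sym (+-suc ∣ p ∣ ∣ q ∣)))
  ∣p∪q∣≤∣p∣+∣q∣ (inside ∷ p)  (outside ∷ q) = s≤s (∣p∪q∣≤∣p∣+∣q∣ p q)
  ∣p∪q∣≤∣p∣+∣q∣ (inside ∷ p)  (inside ∷ q)  =
    s≤s (≤-trans (∣p∪q∣≤∣p∣+∣q∣ p q) (+-monoʳ-≤ ∣ p ∣ (n≤1+n ∣ q ∣)))

image : ∀ {m M} → (Fin m → Fin M) → Subset M
image {zero}  e = ∅
image {suc m} e = ⁅ e zero ⁆ ∪ image (e ∘ suc)

module _ {M : ℕ} where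

  image⁺ : ∀ {m} (e : Fin m → Fin M) j → e j ∈ image e
  image⁺ e zero    = x∈p∪q⁺ (inj₁ (x∈⁅x⁆ (e zero)))
  image⁺ e (suc j) = x∈p∪q⁺ {p = ⁅ e zero ⁆} (inj₂ (image⁺ (e ∘ suc) j))

  image⁻ : ∀ {m} (e : Fin m → Fin M) {x} → x ∈ image e → ∃[ j ] e j ≡ x
  image⁻ {zero}  e x∈ = contradiction x∈ ∉⊥
  image⁻ {suc m} e x∈ with x∈p∪q⁻ ⁅ e zero ⁆ (image (e ∘ suc)) x∈
  ... | inj₁ x∈⁅e₀⁆ = zero , sym (x∈⁅y⁆⇒x≡y (e zero) x∈⁅e₀⁆)
  ... | inj₂ x∈img  = let j , ej≡x = image⁻ (e ∘ suc) x∈img in suc j , ej≡x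

  ∣image∣≤ : ∀ {m} (e : Fin m → Fin M) → ∣ image e ∣ ≤ m
  ∣image∣≤ {zero}  e = ≤-reflexive (∣⊥∣≡0 M)
  ∣image∣≤ {suc m} e = begin
    ∣ ⁅ e zero ⁆ ∪ image (e ∘ suc) ∣      ≤⟨ ∣p∪q∣≤∣p∣+∣q∣ ⁅ e zero ⁆ (image (e ∘ suc)) ⟩
    ∣ ⁅ e zero ⁆ ∣ + ∣ image (e ∘ suc) ∣  ≤⟨ +-mono-≤ (≤-reflexive (∣⁅x⁆∣≡1 (e zero))) (∣image∣≤ (e ∘ suc)) ⟩
    suc m                                 ∎
    where open ≤-Reasoning

module Code {n q M : ℕ} (c : Fin M → Word n q) where

  symbol : Fin M → Fin n → Fin q
  symbol a i = lookup (c a) i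

  Covers : ∀ {m} → (Fin m → Fin M) → Fin M → Set
  Covers e a = ∀ i → ∃[ j ] symbol (e j) i ≡ symbol a i

  covers⇒sameDesc : ∀ {m} {e : Fin m → Fin M} {a} → Covers e a → SameDesc c (image e) (image (a ◂ e))
  covers⇒sameDesc {e = e} {a} covers w = (λ w∈ i → grow (w∈ i)) , (λ w∈ i → shrink i (w∈ i))
    where
    grow : ∀ {i} → ∃[ b ] (b ∈ image e × symbol b i ≡ lookup w i) →
                   ∃[ b ] (b ∈ image (a ◂ e) × symbol b i ≡ lookup w i)
    grow (b , b∈ , b≡w) = b , x∈p∪q⁺ {p = ⁅ a ⁆} (inj₂ b∈) , b≡w
    shrink : ∀ i → ∃[ b ] (b ∈ image (a ◂ e) × symbol b i ≡ lookup w i) →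
                   ∃[ b ] (b ∈ image e × symbol b i ≡ lookup w i)
    shrink i (b , b∈ , b≡w) with x∈p∪q⁻ ⁅ a ⁆ (image e) b∈
    ... | inj₂ b∈e   = b , b∈e , b≡w
    ... | inj₁ b∈⁅a⁆ with x∈⁅y⁆⇒x≡y a b∈⁅a⁆
    ... | refl = let j , ej≡a = covers i in e j , image⁺ e j , trans ej≡a b≡w

  ssc⇒covered⇒member : ∀ {t m} → IsSSC t c → suc m ≤ t → (e : Fin m → Fin M) {a : Fin M} →
                       Covers e a → ∃[ j ] e j ≡ a
  ssc⇒covered⇒member ssc m<t e {a} covers =
    image⁻ e (proj₁ (ssc (image (a ◂ e)) 1≤∣s∣ (≤-trans (∣image∣≤ (a ◂ e)) m<t) a)
                    (image⁺ (a ◂ e) zero) (image e) (covers⇒sameDesc covers))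
    where
    1≤∣s∣ : 1 ≤ ∣ image (a ◂ e) ∣
    1≤∣s∣ = ≤-trans (≤-reflexive (sym (∣⁅x⁆∣≡1 a))) (∣p∣≤∣p∪q∣ ⁅ a ⁆ (image e))

  OwnsAt : Fin M → Fin n → Set
  OwnsAt a k = ∀ b → symbol b k ≡ symbol a k → b ≡ a

  agree⇒≡? : ∀ a k b → Dec (symbol b k ≡ symbol a k → b ≡ a)
  agree⇒≡? a k b = (symbol b k Fin.≟ symbol a k) →-dec (b Fin.≟ a)

  ownsAt? : ∀ a k → Dec (OwnsAt a k)
  ownsAt? a k = all? (agree⇒≡? a k)

  Owner : Fin M → Set
  Owner a = ∃[ k ] OwnsAt a k

  owner? : Decidable Owner
  owner? a = any? (ownsAt? a)

  UniqueAt : Fin n → Fin q → Set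
  UniqueAt k v = ∃[ a ] (symbol a k ≡ v × OwnsAt a k)

  uniqueAt? : ∀ k → Decidable (UniqueAt k)
  uniqueAt? k v = any? (λ a → (symbol a k Fin.≟ v) ×-dec ownsAt? a k)

  uniqueAt⇒ownsAt : ∀ {a k} → UniqueAt k (symbol a k) → OwnsAt a k
  uniqueAt⇒ownsAt {a} (x , x≡a , owns) b b≡a = trans (owns b (trans b≡a (sym x≡a))) (sym (owns a (sym x≡a)))

  ¬owner⇒¬uniqueAt : ∀ {a} → ¬ Owner a → ∀ k → ¬ UniqueAt k (symbol a k)
  ¬owner⇒¬uniqueAt ¬owner k unique = ¬owner (k , uniqueAt⇒ownsAt unique)

  ¬ownsAt⇒twin : ∀ {a k} → ¬ OwnsAt a k → ∃[ b ] (b ≢ a × symbol b k ≡ symbol a k)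
  ¬ownsAt⇒twin {a} {k} ¬owns with ¬∀⟶∃¬ M _ (agree⇒≡? a k) ¬owns
  ... | b , ¬[agree⇒≡] with symbol b k Fin.≟ symbol a k
  ...   | yes agree = b , (λ b≡a → ¬[agree⇒≡] (λ _ → b≡a)) , agree
  ...   | no ¬agree = contradiction (λ agree → contradiction agree ¬agree) ¬[agree⇒≡]

  module _ {a : Fin M} (¬owner : ¬ Owner a) where

    twin : Fin n → Fin M
    twin i = proj₁ (¬ownsAt⇒twin (λ owns → ¬owner (i , owns)))

    twin≢ : ∀ i → twin i ≢ a
    twin≢ i = proj₁ (proj₂ (¬ownsAt⇒twin (λ owns → ¬owner (i , owns))))

    twin-agrees : ∀ i → symbol (twin i) i ≡ symbol a i
    twin-agrees i = proj₂ (proj₂ (¬ownsAt⇒twin (λ owns → ¬owner (i , owns))))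

  ssc⇒owner : ∀ {t} → IsSSC t c → n < t → ∀ a → Owner a
  ssc⇒owner ssc n<t a with owner? a
  ... | yes owner = owner
  ... | no ¬owner =
    let j , twin≡a = ssc⇒covered⇒member ssc n<t (twin ¬owner) (λ i → i , twin-agrees ¬owner i)
    in  contradiction twin≡a (twin≢ ¬owner j)

  owners⇒distinct : (∀ a → Owner a) → Distinct c
  owners⇒distinct owner a b ca≡cb = let k , owns = owner b in owns a (cong (λ w → lookup w k) ca≡cb)

  owners⇒ssc : ∀ {t} → (∀ a → Owner a) → IsSSC t c
  owners⇒ssc owner s _ _ a = a∈s⇒a∈s′ , (λ a∈all → a∈all s (λ _ → id , id))
    where
    a∈s⇒a∈s′ : a ∈ s → ∀ s′ → SameDesc c s′ s → a ∈ s′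
    a∈s⇒a∈s′ a∈s s′ same =
      let k , owns = owner a
          b , b∈s′ , b≡a = proj₂ (same (c a)) (λ i → a , a∈s , refl) k
      in  subst (_∈ s′) (owns b b≡a) b∈s′

  uniqueCount nonUniqueCount : Fin n → ℕ
  uniqueCount k = count (uniqueAt? k)
  nonUniqueCount k = count (¬? ∘ uniqueAt? k)

  uniqueCount+nonUniqueCount : ∑[ k < n ] (uniqueCount k + nonUniqueCount k) ≡ n * q
  uniqueCount+nonUniqueCount = trans (sum-cong-≗ {n} (count+count¬ ∘ uniqueAt?)) (sum-const n q)

  count-owners≤ : count owner? ≤ ∑[ k < n ] uniqueCount k
  count-owners≤ = begin
    ∑[ a < M ] indicator (owner? a)                ≤⟨ sum-mono-≤ (indicator-∃≤count ∘ ownsAt?) ⟩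
    ∑[ a < M ] ∑[ k < n ] indicator (ownsAt? a k)  ≡⟨ ∑-comm (λ a k → indicator (ownsAt? a k)) ⟩
    ∑[ k < n ] count (λ a → ownsAt? a k)           ≤⟨ sum-mono-≤ ownersAt≤ ⟩
    ∑[ k < n ] uniqueCount k                       ∎
    where
    open ≤-Reasoning
    ownersAt≤ : ∀ k → count (λ a → ownsAt? a k) ≤ uniqueCount k
    ownersAt≤ k = count-injective-≤ (λ a → ownsAt? a k) (λ a → symbol a k) (uniqueAt? k)
                    (λ a owns → a , refl , owns) (λ a b _ owns-b a≡b → owns-b a a≡b)

  owners⇒size≤ : (∀ a → Owner a) → 2 ≤ n → 2 ≤ q → M ≤ n * (q ∸ 1)
  owners⇒size≤ owner 2≤n 2≤q with any? (λ k → uniqueCount k ≟ q)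
  ... | yes (k , all-unique) = begin
    M            ≤⟨ Fin.injective⇒≤ symbol-k-injective ⟩
    q            ≤⟨ q≤2*[q∸1] 2≤q ⟩
    2 * (q ∸ 1)  ≤⟨ *-monoˡ-≤ (q ∸ 1) 2≤n ⟩
    n * (q ∸ 1)  ∎
    where
    open ≤-Reasoning
    symbol-k-injective : ∀ {a b} → symbol a k ≡ symbol b k → a ≡ b
    symbol-k-injective {a} {b} = uniqueAt⇒ownsAt (count≡⇒all (uniqueAt? k) all-unique (symbol b k)) a
  ... | no ¬all-unique = begin
    M                         ≡⟨ count-all owner? owner ⟨
    count owner?              ≤⟨ count-owners≤ ⟩
    ∑[ k < n ] uniqueCount k  ≤⟨ sum-mono-≤ uniqueCount<q ⟩
    ∑[ k < n ] (q ∸ 1)        ≡⟨ sum-const n (q ∸ 1) ⟩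
    n * (q ∸ 1)               ∎
    where
    open ≤-Reasoning
    uniqueCount<q : ∀ k → uniqueCount k ≤ q ∸ 1
    uniqueCount<q k = ≤-trans (<⇒≤pred (≤∧≢⇒< (count≤ (uniqueAt? k)) (λ full → ¬all-unique (k , full))))
                              (≤-reflexive (pred[m∸n]≡m∸[1+n] q 0))

module NonOwners {m q M : ℕ} (c : Fin M → Word (suc m) q) where

  open Code c

  removeAt-covers : ∀ {a} (d : Fin (suc m) → Fin M) → (∀ i → symbol (d i) i ≡ symbol a i) →
                    ∀ {k l} → k ≢ l → symbol (d k) l ≡ symbol a l → Covers (removeAt d l) a
  removeAt-covers d d-agrees {k} {l} k≢l dk-agrees i with i Fin.≟ l
  ... | yes refl = punchOut (k≢l ∘ sym) ,
                   trans (cong (λ x → symbol (d x) i) (Fin.punchIn-punchOut (k≢l ∘ sym))) dk-agrees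
  ... | no i≢l   = punchOut (i≢l ∘ sym) ,
                   trans (cong (λ x → symbol (d x) i) (Fin.punchIn-punchOut (i≢l ∘ sym))) (d-agrees i)

  ssc⇒¬owner-agreesOnce : IsSSC (suc m) c → ∀ {a b k l} → ¬ Owner a → k ≢ l →
                          symbol b k ≡ symbol a k → symbol b l ≡ symbol a l → b ≡ a
  ssc⇒¬owner-agreesOnce ssc {a} {b} {k} {l} ¬owner k≢l b-agrees-k b-agrees-l with b Fin.≟ a
  ... | yes b≡a = b≡a
  ... | no b≢a  = let j , dj≡a = covered in contradiction dj≡a (proj₁ (d-replaces (punchIn l j)))
    where
    d : Fin (suc m) → Fin M
    d = updateAt (twin ¬owner) k (λ _ → b)
    d-replaces : ∀ i → d i ≢ a × symbol (d i) i ≡ symbol a i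
    d-replaces i with i Fin.≟ k
    ... | yes refl rewrite updateAt-updates k {λ _ → b} (twin ¬owner) = b≢a , b-agrees-k
    ... | no i≢k rewrite updateAt-minimal i k {λ _ → b} (twin ¬owner) i≢k =
      twin≢ ¬owner i , twin-agrees ¬owner i
    dk-agrees-l : symbol (d k) l ≡ symbol a l
    dk-agrees-l rewrite updateAt-updates k {λ _ → b} (twin ¬owner) = b-agrees-l
    covered : ∃[ j ] removeAt d l j ≡ a
    covered = ssc⇒covered⇒member ssc ≤-refl (removeAt d l)
                (removeAt-covers d (proj₂ ∘ d-replaces) k≢l dk-agrees-l)

  count-nonOwners≤ : IsSSC (suc m) c → ∀ j →
                     count (¬? ∘ owner?) ≤ nonUniqueCount zero * nonUniqueCount (suc j)
  count-nonOwners≤ ssc j = count-≤-fibres (¬? ∘ owner?) (λ a → symbol a zero) (¬? ∘ uniqueAt? zero)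
                             (λ a ¬owner → ¬owner⇒¬uniqueAt ¬owner zero) fibre≤
    where
    fibre≤ : ∀ v → count (fibre? (¬? ∘ owner?) (λ a → symbol a zero) v) ≤ nonUniqueCount (suc j)
    fibre≤ v = count-injective-≤ _ (λ a → symbol a (suc j)) (¬? ∘ uniqueAt? (suc j))
      (λ a (¬owner , _) → ¬owner⇒¬uniqueAt ¬owner (suc j))
      (λ a b (_ , a₀≡v) (¬owner-b , b₀≡v) aⱼ≡bⱼ →
         ssc⇒¬owner-agreesOnce ssc ¬owner-b Fin.0≢1+n (trans a₀≡v (sym b₀≡v)) aⱼ≡bⱼ)

  ssc⇒size≤ : IsSSC (suc m) c → .{{_ : NonZero m}} →
              (q < suc m → M ≤ suc m * q) × (suc m ≤ q → M ≤ q ^ 2)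
  ssc⇒size≤ ssc =
    let few , many = slots-bound m slots count-owners≤ m*nonOwners≤ (count≤ (¬? ∘ uniqueAt? zero)) S≤mq
    in  (λ q≤m → subst (_≤ suc m * q) owners+nonOwners (few q≤m)) ,
        (λ m<q → subst (_≤ q ^ 2) owners+nonOwners (many m<q))
    where
    open ≤-Reasoning
    owners+nonOwners : count owner? + count (¬? ∘ owner?) ≡ M
    owners+nonOwners = count+count¬ owner?
    S : ℕ
    S = ∑[ j < m ] nonUniqueCount (suc j)
    slots : ∑[ k < suc m ] uniqueCount k + (nonUniqueCount zero + S) ≡ suc m * q
    slots = trans (sym (∑-distrib-+ uniqueCount nonUniqueCount)) uniqueCount+nonUniqueCount
    m*nonOwners≤ : m * count (¬? ∘ owner?) ≤ nonUniqueCount zero * S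
    m*nonOwners≤ = begin
      m * count (¬? ∘ owner?)                                    ≡⟨ sum-const m _ ⟨
      ∑[ j < m ] count (¬? ∘ owner?)                             ≤⟨ sum-mono-≤ (count-nonOwners≤ ssc) ⟩
      ∑[ j < m ] (nonUniqueCount zero * nonUniqueCount (suc j))  ≡⟨ *-distribˡ-sum {m} (nonUniqueCount zero) (nonUniqueCount ∘ suc) ⟨
      nonUniqueCount zero * S                                    ∎
    S≤mq : S ≤ m * q
    S≤mq = ≤-trans (sum-mono-≤ (λ j → count≤ (¬? ∘ uniqueAt? (suc j)))) (≤-reflexive (sum-const m q))

module WeightOne (n q : ℕ) where

  entry : Fin n × Fin q → Fin n → Fin (suc q)
  entry (k , v) i with i Fin.≟ k
  ... | yes _ = suc v
  ... | no _  = zero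

  entry-self : ∀ k v → entry (k , v) k ≡ suc v
  entry-self k v with k Fin.≟ k
  ... | yes _  = refl
  ... | no k≢k = contradiction refl k≢k

  entry≡suc⇒≡ : ∀ {k v} kv → entry kv k ≡ suc v → kv ≡ (k , v)
  entry≡suc⇒≡ {k} (k′ , v′) entry≡ with k Fin.≟ k′ | entry≡
  ... | yes refl | refl = refl
  ... | no _     | ()

  code : Fin (n * q) → Word n (suc q)
  code x = tabulate (entry (remQuot q x))

  owner : ∀ x → Code.Owner code x
  owner x = k , λ y agree → begin
    y                                  ≡⟨ Fin.combine-remQuot {n} q y ⟨
    uncurry combine (remQuot {n} q y)  ≡⟨ cong (uncurry combine) (entry≡suc⇒≡ (remQuot q y) (entry-at-k agree)) ⟩
    uncurry combine (k , v)            ≡⟨ Fin.combine-remQuot {n} q x ⟩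
    x                                  ∎
    where
    open ≡-Reasoning
    k = proj₁ (remQuot {n} q x)
    v = proj₂ (remQuot {n} q x)
    entry-at-k : ∀ {y} → lookup (code y) k ≡ lookup (code x) k → entry (remQuot q y) k ≡ suc v
    entry-at-k {y} agree = begin
      entry (remQuot q y) k  ≡⟨ lookup∘tabulate _ k ⟨
      lookup (code y) k      ≡⟨ agree ⟩
      lookup (code x) k      ≡⟨ lookup∘tabulate _ k ⟩
      entry (k , v) k        ≡⟨ entry-self k v ⟩
      suc v                  ∎

length-one⇒size≤ : ∀ {q M} (c : Fin M → Word 1 q) → Distinct c → M ≤ q
length-one⇒size≤ c distinct = Fin.injective⇒≤ {f = λ a → lookup (c a) zero} λ {a} {b} a₀≡b₀ →
  distinct a b (begin
    c a                      ≡⟨ tabulate∘lookup (c a) ⟨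
    tabulate (lookup (c a))  ≡⟨ tabulate-cong {f = lookup (c a)} {g = lookup (c b)} (λ { zero → a₀≡b₀ }) ⟩
    tabulate (lookup (c b))  ≡⟨ tabulate∘lookup (c b) ⟩
    c b                      ∎)
  where open ≡-Reasoning

length≡strength⇒size≤ : ∀ n q′ → 1 ≤ n → 2 ≤ suc q′ →
  (n ≤ suc q′ → SSCBound n n (suc q′) (suc q′ ^ 2)) × (suc q′ < n → SSCBound n n (suc q′) (n * suc q′))
length≡strength⇒size≤ 1 q′ _ 2≤q =
  (λ _ M c distinct _ → begin
      M             ≤⟨ length-one⇒size≤ c distinct ⟩
      suc q′        ≤⟨ m≤m*n (suc q′) (suc q′) ⟩
      suc q′ * suc q′ ≡⟨ q^2≡q*q (suc q′) ⟨
      suc q′ ^ 2    ∎) ,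
  (λ q<1 → contradiction (≤-trans 2≤q (s≤s⁻¹ q<1)) λ ())
  where open ≤-Reasoning
length≡strength⇒size≤ (suc (suc m)) q′ _ _ =
  (λ n≤q M c _ ssc → proj₂ (NonOwners.ssc⇒size≤ c ssc) n≤q) ,
  (λ q<n M c _ ssc → proj₁ (NonOwners.ssc⇒size≤ c ssc) q<n)

lemma11 : (t n q : ℕ) → 1 ≤ t → 2 ≤ q →
          ((2 ≤ n → n < t → MaxSSC t n q (n * (q ∸ 1))) ×
           (n ≡ t → (n ≤ q → SSCBound t n q (q ^ 2)) × (q < n → SSCBound t n q (n * q))))
lemma11 t n (suc q′) 1≤t 2≤q = length<strength , λ { refl → length≡strength⇒size≤ n q′ 1≤t 2≤q }
  where
  open WeightOne n q′
  length<strength : 2 ≤ n → n < t → MaxSSC t n (suc q′) (n * q′)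
  length<strength 2≤n n<t =
    (code , Code.owners⇒distinct code owner , Code.owners⇒ssc code owner) ,
    λ M c _ ssc → Code.owners⇒size≤ c (Code.ssc⇒owner c ssc n<t) 2≤n 2≤q
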